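{- There exists a $5$-dimensional $0/1$-polytope $P\subset\mathbb R^5$ with $25$ vertices such that, for $\mathbf c_{\mathrm{lex}}=(2^1,2^2,2^3,2^4,2^5)$, the sequence $(N_\ell)_\ell$ of the numbers of $\mathbf c_{\mathrm{lex}}$-monotone paths of length $\ell$ on $P$ is not unimodal.
   Context: A $0/1$-polytope in $\mathbb R^n$ is a polytope all of whose vertices lie in $\{0,1\}^n$. For a polytope $P$ and $\mathbf c$ such that $\langle\cdot,\mathbf c\rangle$ attains its minimum and maximum over $P$ at unique vertices $v_{\min}$, $v_{\max}$, let $G_{P,\mathbf c}$ be the directed graph on the vertices of $P$ with an arc $u\to v$ whenever $[u,v]$ is an edge of $P$ with $\langle u,\mathbf c\rangle<\langle v,\mathbf c\rangle$. A $\mathbf c$-monotone path is a directed path in $G_{P,\mathbf c}$ from $v_{\min}$ to $v_{\max}$; its length is its number of edges, and $N_\ell$ is the number of such paths of length $\ell$. A finite sequence $(a_1,\dots,a_r)$ is unimodal if there is $k$ with $a_i\le a_{i+1}$ for $i<k$ and $a_i\ge a_{i+1}$ for $i\ge k$. -}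

module Defs where

open import Data.Nat using (ℕ; zero; suc; _+_; _*_; _≤_; _<_)
open import Data.Integer as ℤ using (ℤ; +_)
open import Data.Bool using (Bool; true; false)
open import Data.Vec using (Vec; []; _∷_; replicate)
open import Data.List using (List; []; _∷_; length)
open import Data.List.Membership.Propositional using (_∈_)
open import Data.List.Relation.Unary.Unique.Propositional using (Unique)
open import Data.Product using (Σ; ∃; ∃-syntax; _×_; _,_)
open import Data.Unit using (⊤)
open import Data.Empty using (⊥)
open import Relation.Binary.PropositionalEquality using (_≡_; _≢_)
open import Relation.Nullary using (¬_)
open import Function.Bundles using (_⇔_)

-- A point of {0,1}^n; index i (as Fin n, starting at 0) is coordinate i+1.
Point : ℕ → Set
Point n = Vec Bool n

bit : Bool → ℕ
bit true  = 1
bit false = 0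

dotℤ : ∀ {n} → Vec ℤ n → Point n → ℤ
dotℤ []       []       = + 0
dotℤ (c ∷ cs) (x ∷ xs) = c ℤ.* (+ bit x) ℤ.+ dotℤ cs xs

dotℕ : ∀ {n} → Vec ℕ n → Point n → ℕ
dotℕ []       []       = 0
dotℕ (c ∷ cs) (x ∷ xs) = c * bit x + dotℕ cs xs

clex : Vec ℕ 5
clex = 2 ∷ 4 ∷ 8 ∷ 16 ∷ 32 ∷ []

-- A 0/1-polytope P = conv V is given by its (duplicate-free) vertex list V.
-- (Every subset of {0,1}^n is in convex position, so V is exactly the vertex set.)

-- P has dimension n: V lies in no affine hyperplane {x | ⟨c,x⟩ = d}, c ≠ 0.
FullDim : ∀ {n} → List (Point n) → Set
FullDim {n} V = (c : Vec ℤ n) (d : ℤ) → (∀ w → w ∈ V → dotℤ c w ≡ d) → c ≡ replicate n (+ 0)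

-- [u,v] is an edge (1-dimensional face) of conv V: some linear functional
-- attains its maximum over V exactly at u and v.
IsEdge : ∀ {n} → List (Point n) → Point n → Point n → Set
IsEdge {n} V u v =
  u ∈ V × v ∈ V × u ≢ v ×
  ∃[ c ] (dotℤ {n} c u ≡ dotℤ c v ×
          (∀ w → w ∈ V → w ≢ u → w ≢ v → dotℤ c w ℤ.< dotℤ c u))

Arc : ∀ {n} → Vec ℕ n → List (Point n) → Point n → Point n → Set
Arc c V u v = IsEdge V u v × dotℕ c u < dotℕ c v

Arcs : ∀ {n} → Vec ℕ n → List (Point n) → List (Point n) → Set
Arcs c V []            = ⊤
Arcs c V (x ∷ [])      = ⊤
Arcs c V (x ∷ y ∷ r)   = Arc c V x y × Arcs c V (y ∷ r)

IsMinVertex : ∀ {n} → Vec ℕ n → List (Point n) → Point n → Set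
IsMinVertex c V x = x ∈ V × (∀ w → w ∈ V → w ≢ x → dotℕ c x < dotℕ c w)

IsMaxVertex : ∀ {n} → Vec ℕ n → List (Point n) → Point n → Set
IsMaxVertex c V x = x ∈ V × (∀ w → w ∈ V → w ≢ x → dotℕ c w < dotℕ c x)

lastOf : ∀ {A : Set} → A → List A → A
lastOf x []      = x
lastOf x (y ∷ r) = lastOf y r

-- p is a c-monotone path of length ℓ (ℓ edges) from v_min to v_max,
-- given as its list of vertices.
MonotonePath : ∀ {n} → Vec ℕ n → List (Point n) → ℕ → List (Point n) → Set
MonotonePath c V ℓ []      = ⊥
MonotonePath c V ℓ (x ∷ r) =
  length r ≡ ℓ × IsMinVertex c V x × IsMaxVertex c V (lastOf x r) × Arcs c V (x ∷ r)

NumMonotonePaths : ∀ {n} → Vec ℕ n → List (Point n) → ℕ → ℕ → Set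
NumMonotonePaths c V ℓ N =
  ∃[ ps ] (Unique ps × length ps ≡ N × (∀ p → (p ∈ ps) ⇔ MonotonePath c V ℓ p))

Unimodal : (ℕ → ℕ) → Set
Unimodal a = ∃[ k ] ((∀ i → suc i ≤ k → a i ≤ a (suc i)) × (∀ i → k ≤ i → a (suc i) ≤ a i))

-- Every edge [u, v] of the graph G_{P,c}
-- is certified by a linear functional maximised over the vertices exactly at u and v, and every
-- other increasing pair by a parallelogram u + v = w + w′ of further vertices, which puts the
-- midpoint of [u, v] inside conv {w, w′}. Enumerating monotone paths in the certified graph gives
-- (N₀, …, N₉) = (0, 0, 0, 2, 47, 118, 84, 88, 44, 0), with the valley 118 > 84 < 88.
module Submission where

open import Defs
open import Data.Nat using (ℕ)
open import Data.List using (List; length)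
open import Data.List.Relation.Unary.Unique.Propositional using (Unique)
open import Data.Product using (∃-syntax; _×_)
open import Relation.Binary.PropositionalEquality using (_≡_)
open import Relation.Nullary using (¬_)

open import Data.Bool as Bool using (Bool; true; false; _xor_)
open import Data.Empty using (⊥; ⊥-elim)
open import Data.Integer as ℤ using (ℤ; +_)
import Data.Integer.Properties as ℤ
open import Data.Integer.Tactic.RingSolver using (solve-∀)
open import Data.List as List using ([]; _∷_; map; filter; concatMap)
import Data.List.Properties as List
open import Data.List.Membership.Propositional using (_∈_; find; lose)
open import Data.List.Membership.Propositional.Properties
  using (∈-map⁺; ∈-map⁻; ∈-concatMap⁺; ∈-concatMap⁻; ∈-filter⁺; ∈-filter⁻)
open import Data.List.Membership.DecPropositional as Membership using ()
open import Data.List.Relation.Binary.Disjoint.Propositional using (Disjoint)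
open import Data.List.Relation.Unary.All as All using (All; []; _∷_)
import Data.List.Relation.Unary.All.Properties as All
open import Data.List.Relation.Unary.Any as Any using (Any; here)
open import Data.List.Relation.Unary.AllPairs as AllPairs using ([]; _∷_)
import Data.List.Relation.Unary.AllPairs.Properties as AllPairs
import Data.List.Relation.Unary.Unique.Propositional.Properties as Unique
open import Data.List.Relation.Unary.Unique.DecPropositional using (unique?)
open import Data.Nat as ℕ using (suc; _<_; _≤_)
open import Data.Nat.Properties as ℕ using (<⇒≱; <⇒≤; ≰⇒>)
open import Data.Product using (_,_; proj₁)
open import Data.Sum using (_⊎_; inj₁; inj₂; [_,_])
open import Data.Unit using (tt)
open import Data.Vec as Vec using (Vec; []; _∷_; replicate)
import Data.Vec.Properties as Vec
open import Function using (_∘_; id)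
open import Function.Bundles using (_⇔_; mk⇔)
open import Relation.Binary.Definitions using (DecidableEquality)
open import Relation.Binary.PropositionalEquality
  using (_≢_; refl; sym; trans; cong; cong₂; subst; module ≡-Reasoning)
open import Relation.Nullary using (Dec; yes; no; ¬?)
open import Relation.Nullary.Decidable using (from-yes; decidable-stable; _×-dec_; _⊎-dec_)

valley⇒¬unimodal : ∀ {a : ℕ → ℕ} i → a (suc i) < a i → a (suc i) < a (suc (suc i)) → ¬ Unimodal a
valley⇒¬unimodal i fall rise (k , increasing , decreasing) with k ℕ.≤? suc i
... | yes k≤1+i = <⇒≱ rise (decreasing (suc i) k≤1+i)
... | no  k≰1+i = <⇒≱ fall (increasing i (<⇒≤ (≰⇒> k≰1+i)))

module _ {n : ℕ} where

  _≟ᵖ_ : DecidableEquality (Point n)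
  _≟ᵖ_ = Vec.≡-dec Bool._≟_

  _∈?_ : (x : Point n) (V : List (Point n)) → Dec (x ∈ V)
  _∈?_ = Membership._∈?_ _≟ᵖ_

  origin : Point n
  origin = replicate n false

  _+ᵖ_ : Point n → Point n → Vec ℕ n
  x +ᵖ y = Vec.zipWith ℕ._+_ (Vec.map bit x) (Vec.map bit y)

  -- When u + v − w is a 0/1 point, it is this one.
  mirror : Point n → Point n → Point n → Point n
  mirror u v w = Vec.zipWith _xor_ (Vec.zipWith _xor_ u v) w

  -- Maximised over {0,1}ⁿ exactly on the smallest face of the cube containing u and v.
  faceFunctional : Point n → Point n → Vec ℤ n
  faceFunctional = Vec.zipWith coefficient
    where
    coefficient : Bool → Bool → ℤ
    coefficient true  true  = ℤ.1ℤ
    coefficient false false = ℤ.-1ℤ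
    coefficient _     _     = ℤ.0ℤ

unitPoints : ∀ n → List (Point n)
unitPoints ℕ.zero = []
unitPoints (suc n) = (true ∷ origin) ∷ map (false ∷_) (unitPoints n)

dotℤ-origin : ∀ {n} (c : Vec ℤ n) → dotℤ c origin ≡ + 0
dotℤ-origin [] = refl
dotℤ-origin (a ∷ c) = cong₂ ℤ._+_ (ℤ.*-zeroʳ a) (dotℤ-origin c)

dotℤ-false∷ : ∀ {n} a (c : Vec ℤ n) x → dotℤ (a ∷ c) (false ∷ x) ≡ dotℤ c x
dotℤ-false∷ a c x = trans (cong (ℤ._+ dotℤ c x) (ℤ.*-zeroʳ a)) (ℤ.+-identityˡ (dotℤ c x))

dotℤ-first-unit : ∀ {n} a (c : Vec ℤ n) → dotℤ (a ∷ c) (true ∷ origin) ≡ a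
dotℤ-first-unit a c = trans (cong₂ ℤ._+_ (ℤ.*-identityʳ a) (dotℤ-origin c)) (ℤ.+-identityʳ a)

vanishing-on-units⇒zero : ∀ {n} (c : Vec ℤ n) → All (λ e → dotℤ c e ≡ + 0) (unitPoints n) →
                          c ≡ replicate n (+ 0)
vanishing-on-units⇒zero [] [] = refl
vanishing-on-units⇒zero (a ∷ c) (first ∷ others) =
  cong₂ _∷_ (trans (sym (dotℤ-first-unit a c)) first)
            (vanishing-on-units⇒zero c (All.map (trans (sym (dotℤ-false∷ a c _))) (All.map⁻ others)))

units⇒fullDim : ∀ {n} {V : List (Point n)} → origin ∈ V → All (_∈ V) (unitPoints n) → FullDim V
units⇒fullDim o∈V units c d on-hyperplane =
  vanishing-on-units⇒zero c
    (All.map (λ e∈V → trans (on-hyperplane _ e∈V) (trans (sym (on-hyperplane _ o∈V)) (dotℤ-origin c)))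
             units)

dotℤ-+ᵖ : ∀ {n} (c : Vec ℤ n) {x y z t : Point n} → x +ᵖ y ≡ z +ᵖ t →
          dotℤ c x ℤ.+ dotℤ c y ≡ dotℤ c z ℤ.+ dotℤ c t
dotℤ-+ᵖ [] {[]} {[]} {[]} {[]} _ = refl
dotℤ-+ᵖ (a ∷ c) {x ∷ xs} {y ∷ ys} {z ∷ zs} {t ∷ ts} sums = begin
  (a ℤ.* + bit x ℤ.+ dotℤ c xs) ℤ.+ (a ℤ.* + bit y ℤ.+ dotℤ c ys)
    ≡⟨ regroup (bit x) (bit y) ⟩
  a ℤ.* + (bit x ℕ.+ bit y) ℤ.+ (dotℤ c xs ℤ.+ dotℤ c ys)
    ≡⟨ cong₂ (λ s r → a ℤ.* + s ℤ.+ r) (Vec.∷-injectiveˡ sums) (dotℤ-+ᵖ c (Vec.∷-injectiveʳ sums)) ⟩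
  a ℤ.* + (bit z ℕ.+ bit t) ℤ.+ (dotℤ c zs ℤ.+ dotℤ c ts)
    ≡⟨ regroup (bit z) (bit t) ⟨
  (a ℤ.* + bit z ℤ.+ dotℤ c zs) ℤ.+ (a ℤ.* + bit t ℤ.+ dotℤ c ts) ∎
  where
  open ≡-Reasoning
  ring : ∀ a p q X Y → (a ℤ.* p ℤ.+ X) ℤ.+ (a ℤ.* q ℤ.+ Y) ≡ a ℤ.* (p ℤ.+ q) ℤ.+ (X ℤ.+ Y)
  ring = solve-∀
  regroup : ∀ {X Y} p q → (a ℤ.* + p ℤ.+ X) ℤ.+ (a ℤ.* + q ℤ.+ Y) ≡ a ℤ.* + (p ℕ.+ q) ℤ.+ (X ℤ.+ Y)
  regroup {X} {Y} p q =
    trans (ring a (+ p) (+ q) X Y) (cong (λ s → a ℤ.* s ℤ.+ (X ℤ.+ Y)) (sym (ℤ.pos-+ p q)))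

module _ {n : ℕ} (V : List (Point n)) where

  EdgeFunctional : Point n → Point n → Vec ℤ n → Set
  EdgeFunctional u v c = dotℤ c u ≡ dotℤ c v × All (λ w → w ≡ u ⊎ w ≡ v ⊎ dotℤ c w ℤ.< dotℤ c u) V

  edgeFunctional? : ∀ u v c → Dec (EdgeFunctional u v c)
  edgeFunctional? u v c =
    dotℤ c u ℤ.≟ dotℤ c v ×-dec All.all? (λ w → w ≟ᵖ u ⊎-dec w ≟ᵖ v ⊎-dec dotℤ c w ℤ.<? dotℤ c u) V

  edgeFunctional⇒isEdge : ∀ {u v} c → u ∈ V → v ∈ V → u ≢ v → EdgeFunctional u v c → IsEdge V u v
  edgeFunctional⇒isEdge {u} {v} c u∈V v∈V u≢v (level , others-below) =
    u∈V , v∈V , u≢v , c , level , λ w w∈V w≢u w≢v →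
      [ ⊥-elim ∘ w≢u , [ ⊥-elim ∘ w≢v , id ] ] (All.lookup others-below w∈V)

  OtherVertex : Point n → Point n → Point n → Set
  OtherVertex u v w = w ∈ V × w ≢ u × w ≢ v

  parallelogram⇒¬isEdge : ∀ {u v w w′} → OtherVertex u v w → OtherVertex u v w′ →
                          u +ᵖ v ≡ w +ᵖ w′ → ¬ IsEdge V u v
  parallelogram⇒¬isEdge {u} {v} {w} {w′} (w∈V , w≢u , w≢v) (w′∈V , w′≢u , w′≢v) sums
                        (_ , _ , _ , c , level , below) = ℤ.<-irrefl refl (begin-strict
    dotℤ c u ℤ.+ dotℤ c v   ≡⟨ dotℤ-+ᵖ c sums ⟩
    dotℤ c w ℤ.+ dotℤ c w′  <⟨ ℤ.+-mono-< (below w w∈V w≢u w≢v) (below w′ w′∈V w′≢u w′≢v) ⟩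
    dotℤ c u ℤ.+ dotℤ c u   ≡⟨ cong (λ z → dotℤ c u ℤ.+ z) level ⟩
    dotℤ c u ℤ.+ dotℤ c v   ∎)
    where open ℤ.≤-Reasoning

  ParallelogramWitness : Point n → Point n → Point n → Set
  ParallelogramWitness u v w =
    u +ᵖ v ≡ w +ᵖ mirror u v w × OtherVertex u v w × OtherVertex u v (mirror u v w)

  parallelogramWitness? : ∀ u v w → Dec (ParallelogramWitness u v w)
  parallelogramWitness? u v w =
    Vec.≡-dec ℕ._≟_ (u +ᵖ v) (w +ᵖ mirror u v w) ×-dec otherVertex? w ×-dec otherVertex? (mirror u v w)
    where
    otherVertex? : ∀ x → Dec (OtherVertex u v x)
    otherVertex? x = x ∈? V ×-dec ¬? (x ≟ᵖ u) ×-dec ¬? (x ≟ᵖ v)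

  parallelogramWitness⇒¬isEdge : ∀ {u v} → Any (ParallelogramWitness u v) V → ¬ IsEdge V u v
  parallelogramWitness⇒¬isEdge witness with Any.satisfied witness
  ... | _ , sums , w , w′ = parallelogram⇒¬isEdge w w′ sums

module _ {n : ℕ} (c : Vec ℕ n) (V : List (Point n)) where

  minVertex-unique : ∀ {x y} → IsMinVertex c V x → IsMinVertex c V y → x ≡ y
  minVertex-unique {x} {y} (x∈V , x-least) (y∈V , y-least) = decidable-stable (x ≟ᵖ y) λ x≢y →
    ℕ.<-asym (x-least y y∈V (x≢y ∘ sym)) (y-least x x∈V x≢y)

  maxVertex-unique : ∀ {x y} → IsMaxVertex c V x → IsMaxVertex c V y → x ≡ y
  maxVertex-unique {x} {y} (x∈V , x-greatest) (y∈V , y-greatest) = decidable-stable (x ≟ᵖ y) λ x≢y →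
    ℕ.<-asym (x-greatest y y∈V (x≢y ∘ sym)) (y-greatest x x∈V x≢y)

  all⇒isMinVertex : ∀ {x} → x ∈ V → All (λ w → w ≡ x ⊎ dotℕ c x < dotℕ c w) V → IsMinVertex c V x
  all⇒isMinVertex x∈V above = x∈V , λ w w∈V w≢x → [ ⊥-elim ∘ w≢x , id ] (All.lookup above w∈V)

  all⇒isMaxVertex : ∀ {x} → x ∈ V → All (λ w → w ≡ x ⊎ dotℕ c w < dotℕ c x) V → IsMaxVertex c V x
  all⇒isMaxVertex x∈V below = x∈V , λ w w∈V w≢x → [ ⊥-elim ∘ w≢x , id ] (All.lookup below w∈V)

  arc-target∈ : ∀ {x y} → Arc c V x y → y ∈ V
  arc-target∈ ((_ , y∈V , _) , _) = y∈V

module MonotonePathEnumeration {n : ℕ} (c : Vec ℕ n) (V : List (Point n))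
  (successors : Point n → List (Point n))
  (successors-sound : ∀ {x y} → x ∈ V → y ∈ successors x → Arc c V x y)
  (successors-complete : ∀ {x y} → Arc c V x y → y ∈ successors x)
  where

  pathsFrom : ℕ → Point n → List (List (Point n))
  pathsFrom ℕ.zero x = (x ∷ []) ∷ []
  pathsFrom (suc k) x = concatMap (map (x ∷_) ∘ pathsFrom k) (successors x)

  ∈-pathsFrom-head : ∀ {k x p} → p ∈ pathsFrom k x → ∃[ r ] p ≡ x ∷ r
  ∈-pathsFrom-head {ℕ.zero} (here refl) = [] , refl
  ∈-pathsFrom-head {suc k} {x} p∈
    with find (∈-concatMap⁻ (map (x ∷_) ∘ pathsFrom k) {xs = successors x} p∈)
  ... | _ , _ , p∈extension with ∈-map⁻ (x ∷_) p∈extension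
  ... | q , _ , refl = q , refl

  ∈-pathsFrom⁻ : ∀ {k x p} → x ∈ V → p ∈ pathsFrom k x →
                 ∃[ r ] (p ≡ x ∷ r × length r ≡ k × Arcs c V (x ∷ r))
  ∈-pathsFrom⁻ {ℕ.zero} _ (here refl) = [] , refl , refl , tt
  ∈-pathsFrom⁻ {suc k} {x} x∈V p∈
    with find (∈-concatMap⁻ (map (x ∷_) ∘ pathsFrom k) {xs = successors x} p∈)
  ... | y , y∈successors , p∈extension with ∈-map⁻ (x ∷_) p∈extension
  ... | q , q∈ , refl with successors-sound x∈V y∈successors
  ... | arc with ∈-pathsFrom⁻ {k} (arc-target∈ c V arc) q∈
  ... | r , refl , |r|≡k , arcs = y ∷ r , refl , cong suc |r|≡k , arc , arcs

  ∈-pathsFrom⁺ : ∀ {k x} r → length r ≡ k → Arcs c V (x ∷ r) → x ∷ r ∈ pathsFrom k x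
  ∈-pathsFrom⁺ {ℕ.zero} [] _ _ = here refl
  ∈-pathsFrom⁺ {suc k} {x} (y ∷ r) |r|≡k (arc , arcs) =
    ∈-concatMap⁺ (map (x ∷_) ∘ pathsFrom k)
      (lose (successors-complete arc) (∈-map⁺ (x ∷_) (∈-pathsFrom⁺ r (ℕ.suc-injective |r|≡k) arcs)))

  pathsFrom-unique : (∀ {x} → x ∈ V → Unique (successors x)) → ∀ k {x} → x ∈ V → Unique (pathsFrom k x)
  pathsFrom-unique _ ℕ.zero _ = [] ∷ []
  pathsFrom-unique successors-unique (suc k) {x} x∈V =
    Unique.concat⁺
      (All.map⁺ (All.tabulate λ y∈ →
        Unique.map⁺ List.∷-injectiveʳ
          (pathsFrom-unique successors-unique k (arc-target∈ c V (successors-sound x∈V y∈)))))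
      (AllPairs.map⁺ (AllPairs.map disjoint (successors-unique x∈V)))
    where
    disjoint : ∀ {y y′} → y ≢ y′ → Disjoint (map (x ∷_) (pathsFrom k y)) (map (x ∷_) (pathsFrom k y′))
    disjoint {y} {y′} y≢y′ (p∈ , p∈′) with ∈-map⁻ (x ∷_) p∈ | ∈-map⁻ (x ∷_) p∈′
    ... | q , q∈ , refl | q′ , q′∈ , x∷q≡x∷q′
      with ∈-pathsFrom-head {k} {y} q∈ | ∈-pathsFrom-head {k} {y′} q′∈
    ... | _ , refl | _ , refl = y≢y′ (List.∷-injectiveˡ (List.∷-injectiveʳ x∷q≡x∷q′))

  EndsAt : Point n → List (Point n) → Set
  EndsAt t []      = ⊥
  EndsAt t (x ∷ r) = lastOf x r ≡ t

  endsAt? : ∀ t p → Dec (EndsAt t p)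
  endsAt? t []      = no λ ()
  endsAt? t (x ∷ r) = lastOf x r ≟ᵖ t

  monotonePaths : Point n → Point n → ℕ → List (List (Point n))
  monotonePaths s t ℓ = filter (endsAt? t) (pathsFrom ℓ s)

  module _ {s t} (s-min : IsMinVertex c V s) (t-max : IsMaxVertex c V t) where

    ∈-monotonePaths⇔ : ∀ ℓ p → p ∈ monotonePaths s t ℓ ⇔ MonotonePath c V ℓ p
    ∈-monotonePaths⇔ ℓ p = mk⇔ to from
      where
      to : ∀ {p} → p ∈ monotonePaths s t ℓ → MonotonePath c V ℓ p
      to p∈ with ∈-filter⁻ (endsAt? t) {xs = pathsFrom ℓ s} p∈
      ... | p∈paths , ends with ∈-pathsFrom⁻ {ℓ} (proj₁ s-min) p∈paths
      ... | r , refl , |r|≡ℓ , arcs = |r|≡ℓ , s-min , subst (IsMaxVertex c V) (sym ends) t-max , arcs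

      from : ∀ {p} → MonotonePath c V ℓ p → p ∈ monotonePaths s t ℓ
      from {x ∷ r} (|r|≡ℓ , x-min , last-max , arcs) with minVertex-unique c V x-min s-min
      ... | refl =
        ∈-filter⁺ (endsAt? t) (∈-pathsFrom⁺ r |r|≡ℓ arcs) (maxVertex-unique c V last-max t-max)

    numMonotonePaths : (∀ {x} → x ∈ V → Unique (successors x)) →
                       ∀ ℓ → NumMonotonePaths c V ℓ (length (monotonePaths s t ℓ))
    numMonotonePaths successors-unique ℓ =
      monotonePaths s t ℓ ,
      Unique.filter⁺ (endsAt? t) (pathsFrom-unique successors-unique ℓ (proj₁ s-min)) ,
      refl , λ p → ∈-monotonePaths⇔ ℓ p

pattern O = false
pattern I = true
pattern pt a b c d e = a ∷ b ∷ c ∷ d ∷ e ∷ []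

vertices : List (Point 5)
vertices =
  pt O O O O O ∷ pt O O O O I ∷ pt O O O I O ∷ pt O O O I I ∷ pt O O I O O ∷
  pt O O I O I ∷ pt O O I I O ∷ pt O I O O O ∷ pt O I O O I ∷ pt O I O I O ∷
  pt O I I O O ∷ pt O I I O I ∷ pt O I I I O ∷ pt I O O O O ∷ pt I O O I O ∷
  pt I O O I I ∷ pt I O I O O ∷ pt I O I I O ∷ pt I O I I I ∷ pt I I O O O ∷
  pt I I O I O ∷ pt I I O I I ∷ pt I I I O O ∷ pt I I I I O ∷ pt I I I I I ∷ []

vmin vmax : Point 5
vmin = pt O O O O O
vmax = pt I I I I I

successors : Point 5 → List (Point 5)
successors (pt O O O O O) = pt O O O O I ∷ pt O O O I O ∷ pt O O I O O ∷ pt O I O O O ∷ pt I O O O O ∷ []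
successors (pt O O O O I) = pt O O O I I ∷ pt O O I O I ∷ pt O I O O I ∷ pt I O O I I ∷ []
successors (pt O O O I O) = pt O O O I I ∷ pt O O I I O ∷ pt O I O I O ∷ pt I O O I O ∷ []
successors (pt O O O I I) = pt I O O I I ∷ pt I O I I I ∷ pt I I O I I ∷ pt I I I I I ∷ []
successors (pt O O I O O) = pt O O I O I ∷ pt O O I I O ∷ pt O I I O O ∷ pt I O I O O ∷ []
successors (pt O O I O I) = pt O O O I I ∷ pt O I I O I ∷ pt I O I I I ∷ []
successors (pt O O I I O) = pt O O O I I ∷ pt O O I O I ∷ pt O I I I O ∷ pt I O I I O ∷ pt I O I I I ∷ []
successors (pt O I O O O) = pt O I O O I ∷ pt O I O I O ∷ pt O I I O O ∷ pt I I O O O ∷ []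
successors (pt O I O O I) = pt O O O I I ∷ pt O I I O I ∷ pt I I O I I ∷ []
successors (pt O I O I O) = pt O O O I I ∷ pt O I O O I ∷ pt O I I I O ∷ pt I I O I O ∷ pt I I O I I ∷ []
successors (pt O I I O O) = pt O I I O I ∷ pt O I I I O ∷ pt I I I O O ∷ []
successors (pt O I I O I) = pt O O O I I ∷ pt I I I I I ∷ []
successors (pt O I I I O) = pt O O O I I ∷ pt O I I O I ∷ pt I I I I O ∷ pt I I I I I ∷ []
successors (pt I O O O O) = pt O O O O I ∷ pt I O O I O ∷ pt I O O I I ∷ pt I O I O O ∷ pt I I O O O ∷ []
successors (pt I O O I O) = pt I O O I I ∷ pt I O I I O ∷ pt I I O I O ∷ []
successors (pt I O O I I) = pt I O I I I ∷ pt I I O I I ∷ []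
successors (pt I O I O O) = pt O O I O I ∷ pt I O I I O ∷ pt I O I I I ∷ pt I I I O O ∷ []
successors (pt I O I I O) = pt I O I I I ∷ pt I I I I O ∷ []
successors (pt I O I I I) = pt I I I I I ∷ []
successors (pt I I O O O) = pt O I O O I ∷ pt I I O I O ∷ pt I I O I I ∷ pt I I I O O ∷ []
successors (pt I I O I O) = pt I I O I I ∷ pt I I I I O ∷ []
successors (pt I I O I I) = pt I I I I I ∷ []
successors (pt I I I O O) = pt O I I O I ∷ pt I I I I O ∷ pt I I I I I ∷ []
successors (pt I I I I O) = pt I I I I I ∷ []
successors _ = []

module _ where
  open import Agda.Builtin.FromNat using (Number; fromNat)
  open import Agda.Builtin.FromNeg using (Negative; fromNeg)
  open import Data.Nat.Literals renaming (number to ℕ-literals)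
  open import Data.Integer.Literals renaming (number to ℤ-literals; negative to ℤ-negative-literals)

  instance
    ℕ-number : Number ℕ
    ℕ-number = ℕ-literals
    ℤ-number : Number ℤ
    ℤ-number = ℤ-literals
    ℤ-negative : Negative ℤ
    ℤ-negative = ℤ-negative-literals

  -- The edges whose smallest cube face contains further vertices.
  edgeFunctional : Point 5 → Point 5 → Vec ℤ 5
  edgeFunctional (pt O O O O I) (pt I O O I I) = 1 ∷ -1 ∷ -1 ∷ -1 ∷ 2 ∷ []
  edgeFunctional (pt O O O I I) (pt I O I I I) = -1 ∷ -1 ∷ 1 ∷ 2 ∷ 2 ∷ []
  edgeFunctional (pt O O O I I) (pt I I O I I) = -1 ∷ 1 ∷ -1 ∷ 2 ∷ 2 ∷ []
  edgeFunctional (pt O O O I I) (pt I I I I I) = -2 ∷ 1 ∷ 1 ∷ 3 ∷ 3 ∷ []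
  edgeFunctional (pt O O I O I) (pt O O O I I) = -2 ∷ -1 ∷ 1 ∷ 1 ∷ 2 ∷ []
  edgeFunctional (pt O O I I O) (pt O O O I I) = -2 ∷ -1 ∷ 1 ∷ 2 ∷ 1 ∷ []
  edgeFunctional (pt O O I I O) (pt O O I O I) = -2 ∷ -1 ∷ 2 ∷ 1 ∷ 1 ∷ []
  edgeFunctional (pt O O I I O) (pt I O I I I) = -1 ∷ -1 ∷ 2 ∷ 2 ∷ 1 ∷ []
  edgeFunctional (pt O I O O I) (pt O O O I I) = -2 ∷ 1 ∷ -1 ∷ 1 ∷ 2 ∷ []
  edgeFunctional (pt O I O I O) (pt O O O I I) = -2 ∷ 1 ∷ -1 ∷ 2 ∷ 1 ∷ []
  edgeFunctional (pt O I O I O) (pt O I O O I) = -2 ∷ 2 ∷ -1 ∷ 1 ∷ 1 ∷ []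
  edgeFunctional (pt O I O I O) (pt I I O I I) = -1 ∷ 2 ∷ -1 ∷ 2 ∷ 1 ∷ []
  edgeFunctional (pt O I I O I) (pt O O O I I) = -3 ∷ 1 ∷ 1 ∷ 2 ∷ 3 ∷ []
  edgeFunctional (pt O I I I O) (pt O O O I I) = -3 ∷ 1 ∷ 1 ∷ 3 ∷ 2 ∷ []
  edgeFunctional (pt O I I I O) (pt O I I O I) = -2 ∷ 1 ∷ 1 ∷ 1 ∷ 1 ∷ []
  edgeFunctional (pt O I I I O) (pt I I I I I) = -1 ∷ 1 ∷ 1 ∷ 2 ∷ 1 ∷ []
  edgeFunctional (pt I O O O O) (pt O O O O I) = 1 ∷ -1 ∷ -1 ∷ -2 ∷ 1 ∷ []
  edgeFunctional (pt I O O O O) (pt I O O I I) = 2 ∷ -1 ∷ -1 ∷ -1 ∷ 1 ∷ []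
  edgeFunctional (pt I O I O O) (pt O O I O I) = 1 ∷ -1 ∷ 1 ∷ -2 ∷ 1 ∷ []
  edgeFunctional (pt I O I O O) (pt I O I I I) = 2 ∷ -1 ∷ 1 ∷ -1 ∷ 1 ∷ []
  edgeFunctional (pt I I O O O) (pt O I O O I) = 1 ∷ 1 ∷ -1 ∷ -2 ∷ 1 ∷ []
  edgeFunctional (pt I I O O O) (pt I I O I I) = 2 ∷ 1 ∷ -1 ∷ -1 ∷ 1 ∷ []
  edgeFunctional (pt I I I O O) (pt O I I O I) = 1 ∷ 1 ∷ 1 ∷ -2 ∷ 1 ∷ []
  edgeFunctional (pt I I I O O) (pt I I I I I) = 2 ∷ 1 ∷ 1 ∷ -1 ∷ 1 ∷ []
  edgeFunctional u v = faceFunctional u v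

ArcCertificate : Point 5 → Point 5 → Set
ArcCertificate u v =
  v ∈ vertices × EdgeFunctional vertices u v (edgeFunctional u v) × dotℕ clex u < dotℕ clex v

NonArcCertificate : Point 5 → Point 5 → Set
NonArcCertificate u v = Any (ParallelogramWitness vertices u v) vertices ⊎ dotℕ clex v ≤ dotℕ clex u

-- Opaque, so that unification never unfolds these computed proofs.
opaque
  successors-certified : All (λ u → All (ArcCertificate u) (successors u)) vertices
  successors-certified = from-yes (All.all? (λ u → All.all? (arcCertificate? u) (successors u)) vertices)
    where
    arcCertificate? : ∀ u v → Dec (ArcCertificate u v)
    arcCertificate? u v =
      v ∈? vertices ×-dec edgeFunctional? vertices u v (edgeFunctional u v) ×-dec
      dotℕ clex u ℕ.<? dotℕ clex v

  non-successors-certified :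
    All (λ u → All (λ v → v ∈ successors u ⊎ NonArcCertificate u v) vertices) vertices
  non-successors-certified = from-yes (All.all? (λ u → All.all? (classified? u) vertices) vertices)
    where
    classified? : ∀ u v → Dec (v ∈ successors u ⊎ NonArcCertificate u v)
    classified? u v = v ∈? successors u ⊎-dec
      Any.any? (parallelogramWitness? vertices u v) vertices ⊎-dec dotℕ clex v ℕ.≤? dotℕ clex u

successors-sound : ∀ {x y} → x ∈ vertices → y ∈ successors x → Arc clex vertices x y
successors-sound {x} {y} x∈V y∈successors
  with All.lookup (All.lookup successors-certified x∈V) y∈successors
... | y∈V , edge , up = edgeFunctional⇒isEdge vertices (edgeFunctional x y) x∈V y∈V x≢y edge , up
  where
  x≢y : x ≢ y
  x≢y x≡y = ℕ.<-irrefl (cong (dotℕ clex) x≡y) up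

successors-complete : ∀ {x y} → Arc clex vertices x y → y ∈ successors x
successors-complete (edge@(x∈V , y∈V , _) , up)
  with All.lookup (All.lookup non-successors-certified x∈V) y∈V
... | inj₁ y∈successors = y∈successors
... | inj₂ (inj₁ parallelogram) = ⊥-elim (parallelogramWitness⇒¬isEdge vertices parallelogram edge)
... | inj₂ (inj₂ down) = ⊥-elim (<⇒≱ up down)

successors-unique : ∀ {x} → x ∈ vertices → Unique (successors x)
successors-unique = All.lookup (from-yes (All.all? (unique? _≟ᵖ_ ∘ successors) vertices))

vertices-unique : Unique vertices
vertices-unique = from-yes (unique? _≟ᵖ_ vertices)

vertices-fullDim : FullDim vertices
vertices-fullDim =
  units⇒fullDim (from-yes (origin ∈? vertices)) (from-yes (All.all? (_∈? vertices) (unitPoints 5)))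

vmin-isMin : IsMinVertex clex vertices vmin
vmin-isMin = all⇒isMinVertex clex vertices (from-yes (vmin ∈? vertices))
  (from-yes (All.all? (λ w → w ≟ᵖ vmin ⊎-dec dotℕ clex vmin ℕ.<? dotℕ clex w) vertices))

vmax-isMax : IsMaxVertex clex vertices vmax
vmax-isMax = all⇒isMaxVertex clex vertices (from-yes (vmax ∈? vertices))
  (from-yes (All.all? (λ w → w ≟ᵖ vmax ⊎-dec dotℕ clex w ℕ.<? dotℕ clex vmax) vertices))

open MonotonePathEnumeration clex vertices successors successors-sound successors-complete

N : ℕ → ℕ
N = length ∘ monotonePaths vmin vmax

N₅ : N 5 ≡ 118
N₅ = refl

N₆ : N 6 ≡ 84
N₆ = refl

N₇ : N 7 ≡ 88
N₇ = refl

N₆<N₅ : N 6 < N 5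
N₆<N₅ rewrite N₅ | N₆ = from-yes (84 ℕ.<? 118)

N₆<N₇ : N 6 < N 7
N₆<N₇ rewrite N₆ | N₇ = from-yes (84 ℕ.<? 88)

theorem4p15 : ∃[ V ] (Unique {A = Point 5} V × length V ≡ 25 × FullDim V ×
    ∃[ N ] ((∀ ℓ → NumMonotonePaths clex V ℓ (N ℓ)) × ¬ Unimodal N))
theorem4p15 =
  vertices , vertices-unique , refl , vertices-fullDim ,
  N , numMonotonePaths vmin-isMin vmax-isMax successors-unique , valley⇒¬unimodal 5 N₆<N₅ N₆<N₇
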